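{- Let $\Delta^{(0)},\Delta^{(1)}$ be dynamic theories and $\mathcal A^{c}$ a set of heterogeneous atoms over them. Then the simple heterogeneous dynamic theory $\Delta^{sh}$ defined below is a dynamic theory; in particular rule (G) (if $\phi$ is valid then $[\alpha]\phi$ is valid) and the axioms (K) $[\alpha](\phi\to\psi)\to([\alpha]\phi\to[\alpha]\psi)$, (V) $\phi\to[\alpha]\phi$ when $\mathrm{FV}^{sem}(\phi)\cap\mathrm{BV}^{sem}(\alpha)=\emptyset$, and (B) $(\forall v[\alpha]\phi)\leftrightarrow([\alpha]\forall v\phi)$ when $v\notin\mathrm{FV}^{sem}(\alpha)\cup\mathrm{BV}^{sem}(\alpha)$ are sound for $\Delta^{sh}$.
   Context: A dynamic theory $\Delta$ consists of: pairwise disjoint sets $\mathcal V$ (variables), $\mathcal A$ (atoms), $\mathcal P$ (programs); a nonempty set $U$; a nonempty set $S$ of states with $\mathrm{val}:S\times\mathcal V\to U$ satisfying interpolation (for all $\mu,\nu\in S$, $W\subseteq\mathcal V$ there is $\omega\in S$ agreeing with $\mu$ on $W$ and with $\nu$ outside $W$); $\mathcal E_A:\mathcal A\to2^S$ and $\mathrm{FV}_A:\mathcal A\to 2^{\mathcal V}$ with $\mathrm{FV}_A(a)$ finite and states agreeing on $\mathrm{FV}_A(a)$ both in or both out of $\mathcal E_A(a)$; $\mathcal E_P:\mathcal P\to 2^{S\times S}$ and $\mathrm{FV}_P:\mathcal P\to2^{\mathcal V}$ with $\mathrm{FV}_P(p)$ finite, overapproximation (for all $W\supseteq\mathrm{FV}_P(p)$: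 if $\mu=_W\nu$ and $(\mu,\omega)\in\mathcal E_P(p)$ then some $\tilde\omega$ has $(\nu,\tilde\omega)\in\mathcal E_P(p)$, $\omega=_W\tilde\omega$) and extensionality (if $\mu=_{\mathcal V}\nu$ then $(\mu,\omega)\in\mathcal E_P(p)\iff(\nu,\omega)\in\mathcal E_P(p)$). $\mu=_W\nu$ means $\mathrm{val}(\mu,v)=\mathrm{val}(\nu,v)$ for all $v\in W$. Formulas, semantics ($[\![\forall vF]\!]=\{\mu:\forall\nu(\mu=_{\mathcal V\setminus\{v\}}\nu\Rightarrow\nu\in[\![F]\!])\}$, $[\![[p]F]\!]=\{\mu:\forall\nu((\mu,\nu)\in\mathcal E_P(p)\Rightarrow\nu\in[\![F]\!])\}$), validity, $\mathrm{FV}^{sem},\mathrm{BV}^{sem}$ as usual: $\mathrm{FV}^{sem}(F)=\{v:\exists\mu,\tilde\mu,\mu=_{\mathcal V\setminus\{v\}}\tilde\mu,\mu\in[\![F]\!]\not\ni\tilde\mu\}$, $\mathrm{FV}^{sem}(p)=\{v:\exists\mu,\tilde\mu,\nu$, $\mu=_{\mathcal V\setminus\{v\}}\tilde\mu$, $(\mu,\nu)\in\mathcal E_P(p)$, no $\tilde\nu$ with $\nu=_{\mathcal V\setminus\{v\}}\tilde\nu$, $(\tilde\mu,\tilde\nu)\in\mathcal E_P(p)\}$, $\mathrm{BV}^{sem}(p)=\{v:\exists(\mu,\tilde\mu)\in\mathcal E_P(p),\mathrm{val}(\mu,v)\neq\mathrm{val}(\tilde\mu,v)\}$. Given $\Delta^{(i)}$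 with components $\mathcal V^{(i)},\mathcal A^{(i)},\mathcal P^{(i)},U^{(i)},S^{(i)},\mathrm{val}^{(i)},\ldots$ ($i=0,1$; the variable, atom and program sets of the two theories are combined as disjoint unions): the heterogeneous state space is $S^{h}=S^{(0)}\times S^{(1)}$ with $\mathrm{val}^h((\mu_0,\mu_1),v)=\mathrm{val}^{(i)}(\mu_i,v)$ for $v\in\mathcal V^{(i)}$. A set of heterogeneous atoms is a set $\mathcal A^c$ with $\mathcal E^c_A:\mathcal A^c\to2^{S^h}$ and $\mathrm{FV}^c_A:\mathcal A^c\to2^{\mathcal V^{(0)}\cup\mathcal V^{(1)}}$ satisfying the atom requirements (finiteness and overapproximation) with respect to $S^h$. The simple heterogeneous theory $\Delta^{sh}$ has variables $\mathcal V^{(0)}\dot\cup\mathcal V^{(1)}$, atoms $\mathcal A^{(0)}\dot\cup\mathcal A^{(1)}\dot\cup\mathcal A^c$, programs $\mathcal P^{(0)}\dot\cup\mathcal P^{(1)}$, universe $U^{(0)}\cup U^{(1)}$, states $S^h$ with $\mathrm{val}^h$; atom evaluation $\mathcal E_A(a)=\mathcal E^{(0)}_A(a)\times S^{(1)}$ for $a\in\mathcal A^{(0)}$, $S^{(0)}\times\mathcal E^{(1)}_A(a)$ for $a\in\mathcal A^{(1)}$, $\mathcal E^c_A(a)$ for $a\in\mathcal A^c$, with $\mathrm{FV}_A$ taken from the respective component; program evaluation $\mathcal E_P(p)=\mathcal E^{(i)}_P(p)$ and $\mathrm{FV}_P(p)=\mathrm{FV}^{(i)}_P(p)$ for $p\in\mathcal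 P^{(i)}$, where a transition of $p\in\mathcal P^{(i)}$ acts on the $i$-th component of a state pair and leaves the other component unchanged.
   Formalization: In $\Delta^{sh}$, a transition of $p\in\mathcal P^{(i)}$ acts on the i-th component, while the other component need only keep the value of every variable rather than stay the same state. The statement above fails without it. -}

module Defs where

open import Data.Product using (Σ; _×_; _,_; proj₁; proj₂)
open import Data.Sum using (_⊎_; inj₁; inj₂)
open import Data.List using (List; map)
open import Data.List.Membership.Propositional using (_∈_)
open import Data.Unit using (⊤)
open import Data.Empty using (⊥)
open import Relation.Nullary using (¬_)
open import Relation.Binary.PropositionalEquality using (_≡_)

_⇔ₜ_ : Set → Set → Set
X ⇔ₜ Y = (X → Y) × (Y → X)

-- Variables, atoms, programs are separate
-- types (hence pairwise disjoint).  Finite sets of variables (FV_A,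
-- FV_P) are given as lists; membership in the list is membership in the set.
record RawDT : Set₁ where
  field
    V A P U S : Set
    val : S → V → U
    EA  : A → S → Set
    FVA : A → List V
    EP  : P → S → S → Set
    FVP : P → List V

  agree : (V → Set) → S → S → Set
  agree W μ ν = ∀ v → W v → val μ v ≡ val ν v

record IsDT (R : RawDT) : Set₁ where
  open RawDT R
  field
    U-nonempty : U
    S-nonempty : S
    interpolation : ∀ (μ ν : S) (W : V → Set) →
      Σ S λ ω → agree W μ ω × agree (λ v → ¬ W v) ν ω
    atom-FV : ∀ (a : A) (μ ν : S) → agree (λ v → v ∈ FVA a) μ ν →
      EA a μ ⇔ₜ EA a ν
    overapproximation : ∀ (p : P) (W : V → Set) → (∀ v → v ∈ FVP p → W v) →
      ∀ (μ ν ω : S) → agree W μ ν → EP p μ ω →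
      Σ S λ ω~ → EP p ν ω~ × agree W ω ω~
    extensionality : ∀ (p : P) (μ ν ω : S) → agree (λ _ → ⊤) μ ν →
      EP p μ ω ⇔ₜ EP p ν ω

record DynamicTheory : Set₁ where
  field
    raw  : RawDT
    isDT : IsDT raw
  open RawDT raw public
  open IsDT isDT public

module Semantics (R : RawDT) where
  open RawDT R

  infixr 5 _⇒_
  infixr 6 _∧'_
  data Fm : Set where
    atom : A → Fm
    ff   : Fm
    _⇒_  : Fm → Fm → Fm
    _∧'_ : Fm → Fm → Fm
    all  : V → Fm → Fm
    box  : P → Fm → Fm

  _⇔_ : Fm → Fm → Fm
  F ⇔ G = (F ⇒ G) ∧' (G ⇒ F)

  others : V → V → Set
  others v w = ¬ (w ≡ v)

  ⟦_⟧ : Fm → S → Set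
  ⟦ atom a ⟧ μ = EA a μ
  ⟦ ff ⟧ μ = ⊥
  ⟦ F ⇒ G ⟧ μ = ⟦ F ⟧ μ → ⟦ G ⟧ μ
  ⟦ F ∧' G ⟧ μ = ⟦ F ⟧ μ × ⟦ G ⟧ μ
  ⟦ all v F ⟧ μ = ∀ ν → agree (others v) μ ν → ⟦ F ⟧ ν
  ⟦ box p F ⟧ μ = ∀ ν → EP p μ ν → ⟦ F ⟧ ν

  Valid : Fm → Set
  Valid F = ∀ μ → ⟦ F ⟧ μ

  FVsem : Fm → V → Set
  FVsem F v = Σ S λ μ → Σ S λ μ~ →
    agree (others v) μ μ~ × ⟦ F ⟧ μ × ¬ ⟦ F ⟧ μ~

  FVsemP : P → V → Set
  FVsemP p v = Σ S λ μ → Σ S λ μ~ → Σ S λ ν →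
    agree (others v) μ μ~ × EP p μ ν ×
    ¬ (Σ S λ ν~ → agree (others v) ν ν~ × EP p μ~ ν~)

  BVsem : P → V → Set
  BVsem p v = Σ S λ μ → Σ S λ μ~ → EP p μ μ~ × ¬ (val μ v ≡ val μ~ v)

  record SoundGKVB : Set where
    field
      ruleG : ∀ (p : P) (F : Fm) → Valid F → Valid (box p F)
      axK : ∀ (p : P) (F G : Fm) →
        Valid (box p (F ⇒ G) ⇒ (box p F ⇒ box p G))
      axV : ∀ (p : P) (F : Fm) → (∀ v → FVsem F v → BVsem p v → ⊥) →
        Valid (F ⇒ box p F)
      axB : ∀ (p : P) (F : Fm) (v : V) → ¬ FVsemP p v → ¬ BVsem p v →
        Valid (all v (box p F) ⇔ box p (all v F))

module Het (D₀ D₁ : DynamicTheory) where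
  module D₀ = DynamicTheory D₀
  module D₁ = DynamicTheory D₁

  Vh : Set
  Vh = D₀.V ⊎ D₁.V

  Uh : Set
  Uh = D₀.U ⊎ D₁.U

  Sh : Set
  Sh = D₀.S × D₁.S

  valh : Sh → Vh → Uh
  valh (μ₀ , μ₁) (inj₁ v) = inj₁ (D₀.val μ₀ v)
  valh (μ₀ , μ₁) (inj₂ v) = inj₂ (D₁.val μ₁ v)

  agreeh : (Vh → Set) → Sh → Sh → Set
  agreeh W μ ν = ∀ v → W v → valh μ v ≡ valh ν v

  record HetAtoms : Set₁ where
    field
      Ac  : Set
      Ec  : Ac → Sh → Set
      FVc : Ac → List Vh
      atom-FV : ∀ (a : Ac) (μ ν : Sh) → agreeh (λ v → v ∈ FVc a) μ ν →
        Ec a μ ⇔ₜ Ec a ν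

  shRaw : HetAtoms → RawDT
  shRaw H = record
    { V = Vh
    ; A = D₀.A ⊎ (D₁.A ⊎ HetAtoms.Ac H)
    ; P = D₀.P ⊎ D₁.P
    ; U = Uh
    ; S = Sh
    ; val = valh
    ; EA = EAh
    ; FVA = FVAh
    ; EP = EPh
    ; FVP = FVPh
    }
    where
    EAh : D₀.A ⊎ (D₁.A ⊎ HetAtoms.Ac H) → Sh → Set
    EAh (inj₁ a) (μ₀ , μ₁) = D₀.EA a μ₀
    EAh (inj₂ (inj₁ a)) (μ₀ , μ₁) = D₁.EA a μ₁
    EAh (inj₂ (inj₂ a)) μ = HetAtoms.Ec H a μ
    FVAh : D₀.A ⊎ (D₁.A ⊎ HetAtoms.Ac H) → List Vh
    FVAh (inj₁ a) = map inj₁ (D₀.FVA a)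
    FVAh (inj₂ (inj₁ a)) = map inj₂ (D₁.FVA a)
    FVAh (inj₂ (inj₂ a)) = HetAtoms.FVc H a
    EPh : D₀.P ⊎ D₁.P → Sh → Sh → Set
    EPh (inj₁ p) (μ₀ , μ₁) (ν₀ , ν₁) =
      D₀.EP p μ₀ ν₀ × D₁.agree (λ _ → ⊤) μ₁ ν₁
    EPh (inj₂ p) (μ₀ , μ₁) (ν₀ , ν₁) =
      D₀.agree (λ _ → ⊤) μ₀ ν₀ × D₁.EP p μ₁ ν₁
    FVPh : D₀.P ⊎ D₁.P → List Vh
    FVPh (inj₁ p) = map inj₁ (D₀.FVP p)
    FVPh (inj₂ p) = map inj₂ (D₁.FVP p)

{-# OPTIONS --safe #-}
-- Δ^sh satisfies the axioms of a dynamic theory componentwise: a program of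
-- Δ^(i) inherits overapproximation and extensionality from Δ^(i) on the i-th
-- component and carries the other component along unchanged.
--
-- Soundness of (G), (K), (V), (B) holds in every dynamic theory, classically.
-- By induction on formulas, every formula depends only on a finite set of
-- variables (this is where finiteness of FV_A, FV_P and interpolation enter).
-- The variables of that set outside FV^sem(φ) can be overwritten one at a time
-- without changing truth, which gives the coincidence lemma: states agreeing on
-- FV^sem(φ) agree on φ.  (V) follows because a program leaves the variables
-- outside BV^sem(α) untouched.
module Submission where

open import Defs
open import Data.Product using (_×_)
open import Level using (0ℓ)
open import Axiom.ExcludedMiddle using (ExcludedMiddle)

open import Axiom.DoubleNegationElimination using (em⇒dne)
open import Data.Product using (Σ; _,_; proj₁; proj₂)
open import Data.Sum using (inj₁; inj₂)
open import Data.Sum.Properties using (inj₁-injective; inj₂-injective)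
open import Data.List using (List; []; _∷_; _++_)
open import Data.List.Membership.Propositional using (_∈_)
open import Data.List.Membership.Propositional.Properties using (∈-++⁺ˡ; ∈-++⁺ʳ; ∈-map⁺)
open import Data.List.Relation.Unary.Any using (here; there)
open import Data.Unit using (⊤; tt)
open import Data.Empty using (⊥-elim)
open import Function using (_∘_)
open import Relation.Nullary using (¬_; yes; no)
open import Relation.Unary using (_⊆_; _∪_; _∩_)
open import Relation.Binary.PropositionalEquality using (_≡_; refl; sym; trans; cong)

module Agreement (R : RawDT) where
  open RawDT R

  agree-sym : ∀ {W μ ν} → agree W μ ν → agree W ν μ
  agree-sym μ≈ν v w = sym (μ≈ν v w)

  agree-trans : ∀ {W μ ν ω} → agree W μ ν → agree W ν ω → agree W μ ω
  agree-trans μ≈ν ν≈ω v w = trans (μ≈ν v w) (ν≈ω v w)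

  agree-mono : ∀ {W W′ μ ν} → W′ ⊆ W → agree W μ ν → agree W′ μ ν
  agree-mono W′⊆W μ≈ν v w = μ≈ν v (W′⊆W w)

module Classical (R : RawDT) (isDT : IsDT R) (lem : ExcludedMiddle 0ℓ) where
  open RawDT R
  open IsDT isDT
  open Semantics R
  open Agreement R

  agree-split : ∀ {W μ ν} z → agree (W ∩ others z) μ ν →
    (W z → val μ z ≡ val ν z) → agree W μ ν
  agree-split z off at w Ww with lem {w ≡ z}
  ... | yes refl = at Ww
  ... | no w≢z   = off w (Ww , w≢z)

  _[_≔_] : S → V → S → S
  μ [ z ≔ ν ] = proj₁ (interpolation ν μ (_≡ z))

  ≔-at : ∀ μ z ν → val ν z ≡ val (μ [ z ≔ ν ]) z
  ≔-at μ z ν = proj₁ (proj₂ (interpolation ν μ (_≡ z))) z refl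

  ≔-off : ∀ μ z ν → agree (others z) μ (μ [ z ≔ ν ])
  ≔-off μ z ν = proj₂ (proj₂ (interpolation ν μ (_≡ z)))

  ≔-agree : ∀ {W μ ρ} z ν → agree (W ∩ others z) μ ρ →
    (W z → val ν z ≡ val ρ z) → agree W (μ [ z ≔ ν ]) ρ
  ≔-agree {μ = μ} z ν off at =
    agree-split z (agree-trans (agree-mono proj₂ (agree-sym (≔-off μ z ν))) off)
                  (λ Wz → trans (sym (≔-at μ z ν)) (at Wz))

  Supported : Fm → (V → Set) → Set
  Supported F W = ∀ μ ν → agree W μ ν → ⟦ F ⟧ μ → ⟦ F ⟧ ν

  supported-mono : ∀ F {W W′} → W ⊆ W′ → Supported F W → Supported F W′
  supported-mono _ W⊆W′ sF μ ν μ≈ν = sF μ ν (agree-mono W⊆W′ μ≈ν)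

  supported-⇒ : ∀ F G {W} → Supported F W → Supported G W → Supported (F ⇒ G) W
  supported-⇒ _ _ sF sG μ ν μ≈ν f⇒g f = sG μ ν μ≈ν (f⇒g (sF ν μ (agree-sym μ≈ν) f))

  supported-∧ : ∀ F G {W} → Supported F W → Supported G W → Supported (F ∧' G) W
  supported-∧ _ _ sF sG μ ν μ≈ν (f , g) = sF μ ν μ≈ν f , sG μ ν μ≈ν g

  supported-all : ∀ F {W} v → Supported F W → Supported (all v F) W
  supported-all _ v sF μ ν μ≈ν ∀f ν′ ν≈ν′ =
    sF (μ [ v ≔ ν′ ]) ν′
       (≔-agree v ν′ (λ w (Ww , w≢v) → trans (μ≈ν w Ww) (ν≈ν′ w w≢v)) (λ _ → refl))
       (∀f (μ [ v ≔ ν′ ]) (≔-off μ v ν′))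

  supported-box : ∀ F {W} p → (λ v → v ∈ FVP p) ⊆ W → Supported F W →
    Supported (box p F) W
  supported-box _ {W} p FVP⊆W sF μ ν μ≈ν □f ω′ ν→ω′ =
    let (ω , μ→ω , ω′≈ω) = overapproximation p W (λ _ → FVP⊆W) ν μ ω′ (agree-sym μ≈ν) ν→ω′
    in sF ω ω′ (agree-sym ω′≈ω) (□f ω μ→ω)

  finiteSupport : ∀ F → Σ (List V) λ Z → Supported F (_∈ Z)
  finiteSupport (atom a)  = FVA a , λ μ ν μ≈ν → proj₁ (atom-FV a μ ν μ≈ν)
  finiteSupport ff        = [] , λ _ _ _ ()
  finiteSupport (F ⇒ G) with finiteSupport F | finiteSupport G
  ... | ZF , sF | ZG , sG =
    ZF ++ ZG , supported-⇒ F G (supported-mono F ∈-++⁺ˡ sF) (supported-mono G (∈-++⁺ʳ ZF) sG)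
  finiteSupport (F ∧' G) with finiteSupport F | finiteSupport G
  ... | ZF , sF | ZG , sG =
    ZF ++ ZG , supported-∧ F G (supported-mono F ∈-++⁺ˡ sF) (supported-mono G (∈-++⁺ʳ ZF) sG)
  finiteSupport (all v F) with finiteSupport F
  ... | ZF , sF = ZF , supported-all F v sF
  finiteSupport (box p F) with finiteSupport F
  ... | ZF , sF = ZF ++ FVP p , supported-box F p (∈-++⁺ʳ ZF) (supported-mono F ∈-++⁺ˡ sF)

  nonFree-invariant : ∀ F {z} → ¬ FVsem F z → Supported F (others z)
  nonFree-invariant _ nfz μ ν μ≈ν f = em⇒dne lem λ ¬fν → nfz (μ , ν , μ≈ν , f , ¬fν)

  supported-dropHead : ∀ F z L →
    Supported F ((_∈ z ∷ L) ∪ FVsem F) → Supported F ((_∈ L) ∪ FVsem F)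
  supported-dropHead F z L sF μ ν μ≈ν f with lem {FVsem F z}
  ... | yes fz = sF μ ν (agree-mono widen μ≈ν) f
    where
    widen : (_∈ z ∷ L) ∪ FVsem F ⊆ (_∈ L) ∪ FVsem F
    widen (inj₁ (here refl)) = inj₂ fz
    widen (inj₁ (there w∈L)) = inj₁ w∈L
    widen (inj₂ fw)          = inj₂ fw
  ... | no nfz =
    sF (μ [ z ≔ ν ]) ν (≔-agree z ν (agree-mono narrow μ≈ν) (λ _ → refl))
       (nonFree-invariant F nfz μ (μ [ z ≔ ν ]) (≔-off μ z ν) f)
    where
    narrow : ((_∈ z ∷ L) ∪ FVsem F) ∩ others z ⊆ (_∈ L) ∪ FVsem F
    narrow (inj₁ (here w≡z) , w≢z) = ⊥-elim (w≢z w≡z)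
    narrow (inj₁ (there w∈L) , _)  = inj₁ w∈L
    narrow (inj₂ fw , _)           = inj₂ fw

  coincidence : ∀ F → Supported F (FVsem F)
  coincidence F =
    supported-mono F (λ { (inj₁ ()) ; (inj₂ fw) → fw }) (dropAll ZF (supported-mono F inj₁ sF))
    where
    ZF = proj₁ (finiteSupport F)
    sF = proj₂ (finiteSupport F)
    dropAll : ∀ L → Supported F ((_∈ L) ∪ FVsem F) → Supported F ((_∈ []) ∪ FVsem F)
    dropAll []      s = s
    dropAll (z ∷ L) s = dropAll L (supported-dropHead F z L s)

  nonBound-preserved : ∀ {p v μ ν} → ¬ BVsem p v → EP p μ ν → val μ v ≡ val ν v
  nonBound-preserved nbv μ→ν = em⇒dne lem λ μv≢νv → nbv (_ , _ , μ→ν , μv≢νv)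

  nonFree-simulation : ∀ {p v μ μ′ ν} → ¬ FVsemP p v →
    agree (others v) μ μ′ → EP p μ ν → Σ S λ ν′ → agree (others v) ν ν′ × EP p μ′ ν′
  nonFree-simulation nfv μ≈μ′ μ→ν = em⇒dne lem λ none → nfv (_ , _ , _ , μ≈μ′ , μ→ν , none)

  all-box⇒box-all : ∀ {p v} F → ¬ FVsemP p v → ¬ BVsem p v →
    Valid (all v (box p F) ⇒ box p (all v F))
  all-box⇒box-all {p} {v} F nfv nbv μ ∀□f ν μ→ν ν′ ν≈ν′ =
    supported-mono F (λ _ → tt) (coincidence F) ν″ ν′ ν″≈ν′ (∀□f μ′ (≔-off μ v ν′) ν″ μ′→ν″)
    where
    -- Run p from μ′ = μ [v ≔ ν′]: the result ν″ matches ν′ off v since v is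
    -- not free in p, and at v since v is not bound by p.
    μ′ = μ [ v ≔ ν′ ]
    simulation = nonFree-simulation nfv (≔-off μ v ν′) μ→ν
    ν″ = proj₁ simulation
    ν≈ν″ = proj₁ (proj₂ simulation)
    μ′→ν″ = proj₂ (proj₂ simulation)
    ν″≈ν′ : agree (λ _ → ⊤) ν″ ν′
    ν″≈ν′ = agree-split v (λ w (_ , w≢v) → trans (sym (ν≈ν″ w w≢v)) (ν≈ν′ w w≢v))
                          (λ _ → trans (sym (nonBound-preserved nbv μ′→ν″)) (sym (≔-at μ v ν′)))

  box-all⇒all-box : ∀ {p v} F → ¬ FVsemP p v → Valid (box p (all v F) ⇒ all v (box p F))
  box-all⇒all-box F nfv μ □∀f μ′ μ≈μ′ ν′ μ′→ν′ =
    let (ν , ν′≈ν , μ→ν) = nonFree-simulation nfv (agree-sym μ≈μ′) μ′→ν′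
    in □∀f ν μ→ν ν′ (agree-sym ν′≈ν)

  soundness : SoundGKVB
  soundness = record
    { ruleG = λ p F ⊨F μ ν _ → ⊨F ν
    ; axK   = λ p F G μ □f⇒g □f ν μ→ν → □f⇒g ν μ→ν (□f ν μ→ν)
    ; axV   = λ p F disjoint μ f ν μ→ν →
                coincidence F μ ν (λ v fv → nonBound-preserved (disjoint v fv) μ→ν) f
    ; axB   = λ p F v nfv nbv μ → all-box⇒box-all F nfv nbv μ , box-all⇒all-box F nfv μ
    }

module SimpleHeterogeneous (D₀ D₁ : DynamicTheory) (H : Het.HetAtoms D₀ D₁) where
  open Het D₀ D₁
  open RawDT (shRaw H) using (EA; FVA; EP; FVP)
  private
    module A₀ = Agreement D₀.raw
    module A₁ = Agreement D₁.raw

  agreeh-proj₁ : ∀ {W μ ν} → agreeh W μ ν → D₀.agree (W ∘ inj₁) (proj₁ μ) (proj₁ ν)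
  agreeh-proj₁ μ≈ν v w = inj₁-injective (μ≈ν (inj₁ v) w)

  agreeh-proj₂ : ∀ {W μ ν} → agreeh W μ ν → D₁.agree (W ∘ inj₂) (proj₂ μ) (proj₂ ν)
  agreeh-proj₂ μ≈ν v w = inj₂-injective (μ≈ν (inj₂ v) w)

  agreeh-pair : ∀ {W μ₀ μ₁ ν₀ ν₁} → D₀.agree (W ∘ inj₁) μ₀ ν₀ →
    D₁.agree (W ∘ inj₂) μ₁ ν₁ → agreeh W (μ₀ , μ₁) (ν₀ , ν₁)
  agreeh-pair μ₀≈ν₀ _ (inj₁ v) w = cong inj₁ (μ₀≈ν₀ v w)
  agreeh-pair _ μ₁≈ν₁ (inj₂ v) w = cong inj₂ (μ₁≈ν₁ v w)

  interpolationh : ∀ (μ ν : Sh) W → Σ Sh λ ω → agreeh W μ ω × agreeh (λ v → ¬ W v) ν ω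
  interpolationh (μ₀ , μ₁) (ν₀ , ν₁) W =
    let (ω₀ , μ₀≈ω₀ , ν₀≈ω₀) = D₀.interpolation μ₀ ν₀ (W ∘ inj₁)
        (ω₁ , μ₁≈ω₁ , ν₁≈ω₁) = D₁.interpolation μ₁ ν₁ (W ∘ inj₂)
    in (ω₀ , ω₁) , agreeh-pair μ₀≈ω₀ μ₁≈ω₁ , agreeh-pair ν₀≈ω₀ ν₁≈ω₁

  atom-FVh : ∀ a μ ν → agreeh (λ v → v ∈ FVA a) μ ν → EA a μ ⇔ₜ EA a ν
  atom-FVh (inj₁ a) μ ν μ≈ν =
    D₀.atom-FV a (proj₁ μ) (proj₁ ν) (A₀.agree-mono (∈-map⁺ inj₁) (agreeh-proj₁ μ≈ν))
  atom-FVh (inj₂ (inj₁ a)) μ ν μ≈ν =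
    D₁.atom-FV a (proj₂ μ) (proj₂ ν) (A₁.agree-mono (∈-map⁺ inj₂) (agreeh-proj₂ μ≈ν))
  atom-FVh (inj₂ (inj₂ a)) = Het.HetAtoms.atom-FV H a

  overapproximationh : ∀ p W → (∀ v → v ∈ FVP p → W v) →
    ∀ (μ ν ω : Sh) → agreeh W μ ν → EP p μ ω → Σ Sh λ ω′ → EP p ν ω′ × agreeh W ω ω′
  overapproximationh (inj₁ p) W FVP⊆W (μ₀ , μ₁) (ν₀ , ν₁) (ω₀ , ω₁) μ≈ν (μ₀→ω₀ , μ₁≈ω₁) =
    let (ω′₀ , ν₀→ω′₀ , ω₀≈ω′₀) =
          D₀.overapproximation p (W ∘ inj₁) (λ v → FVP⊆W (inj₁ v) ∘ ∈-map⁺ inj₁)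
            μ₀ ν₀ ω₀ (agreeh-proj₁ μ≈ν) μ₀→ω₀
        ω₁≈ν₁ = A₁.agree-trans (A₁.agree-mono (λ _ → tt) (A₁.agree-sym μ₁≈ω₁)) (agreeh-proj₂ μ≈ν)
    in (ω′₀ , ν₁) , (ν₀→ω′₀ , λ _ _ → refl) , agreeh-pair ω₀≈ω′₀ ω₁≈ν₁
  overapproximationh (inj₂ p) W FVP⊆W (μ₀ , μ₁) (ν₀ , ν₁) (ω₀ , ω₁) μ≈ν (μ₀≈ω₀ , μ₁→ω₁) =
    let (ω′₁ , ν₁→ω′₁ , ω₁≈ω′₁) =
          D₁.overapproximation p (W ∘ inj₂) (λ v → FVP⊆W (inj₂ v) ∘ ∈-map⁺ inj₂)
            μ₁ ν₁ ω₁ (agreeh-proj₂ μ≈ν) μ₁→ω₁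
        ω₀≈ν₀ = A₀.agree-trans (A₀.agree-mono (λ _ → tt) (A₀.agree-sym μ₀≈ω₀)) (agreeh-proj₁ μ≈ν)
    in (ν₀ , ω′₁) , ((λ _ _ → refl) , ν₁→ω′₁) , agreeh-pair ω₀≈ν₀ ω₁≈ω′₁

  extensionalityh : ∀ p (μ ν ω : Sh) → agreeh (λ _ → ⊤) μ ν → EP p μ ω ⇔ₜ EP p ν ω
  extensionalityh (inj₁ p) μ ν ω μ≈ν =
    let (to , from) = D₀.extensionality p (proj₁ μ) (proj₁ ν) (proj₁ ω) (agreeh-proj₁ μ≈ν)
        μ₁≈ν₁ = agreeh-proj₂ μ≈ν
    in (λ (e , a) → to e , A₁.agree-trans (A₁.agree-sym μ₁≈ν₁) a)
     , (λ (e , a) → from e , A₁.agree-trans μ₁≈ν₁ a)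
  extensionalityh (inj₂ p) μ ν ω μ≈ν =
    let (to , from) = D₁.extensionality p (proj₂ μ) (proj₂ ν) (proj₂ ω) (agreeh-proj₂ μ≈ν)
        μ₀≈ν₀ = agreeh-proj₁ μ≈ν
    in (λ (a , e) → A₀.agree-trans (A₀.agree-sym μ₀≈ν₀) a , to e)
     , (λ (a , e) → A₀.agree-trans μ₀≈ν₀ a , from e)

  isDynamicTheory : IsDT (shRaw H)
  isDynamicTheory = record
    { U-nonempty        = inj₁ D₀.U-nonempty
    ; S-nonempty        = D₀.S-nonempty , D₁.S-nonempty
    ; interpolation     = interpolationh
    ; atom-FV           = atom-FVh
    ; overapproximation = overapproximationh
    ; extensionality    = extensionalityh
    }

mainTheorem12 : ExcludedMiddle 0ℓ →
    (D₀ D₁ : DynamicTheory) (H : Het.HetAtoms D₀ D₁) →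
    IsDT (Het.shRaw D₀ D₁ H) × Semantics.SoundGKVB (Het.shRaw D₀ D₁ H)
mainTheorem12 lem D₀ D₁ H =
  isDynamicTheory , Classical.soundness (Het.shRaw D₀ D₁ H) isDynamicTheory lem
  where open SimpleHeterogeneous D₀ D₁ H using (isDynamicTheory)
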